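{- For each integer $p\geq 2$, $S_p$ is a subgraph of $L_3(\theta_{3,p})$, and consequently ${\rm ex}(n, S_p)\leq {\rm ex}(n,L_3(\theta_{3,p}))$.
   Context: A $3$-comb $T_3$ is the tree obtained from a path $abc$ by adding three new vertices $a',b',c'$ and edges $aa',bb',cc'$. $S_p$ is obtained by taking $p$ vertex-disjoint copies of $T_3$ and identifying all images of $a'$ into one vertex, all images of $b'$ into one vertex, and all images of $c'$ into one vertex. $\theta_{3,p}$ is the graph consisting of $p$ internally vertex-disjoint paths of length $3$ joining a pair of vertices; it is bipartite and symmetric between its two parts. For a bipartite graph $H$ with an ordered pair $(A,B)$ of parts and an integer $t\ge 2$, $L_t(H)$ is obtained from $H$ by adding a new vertex $u$ and joining $u$ to every vertex of $A$ by internally disjoint paths of length $t-1$ whose internal vertices are new (disjoint from $V(H)$). ${\rm ex}(n,H)$ is the maximum number of edges in an $n$-vertex graph containing no copy of $H$. -}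

module Defs where

open import Data.Nat using (ℕ; _≤_; _<ᵇ_)
open import Data.Fin using (Fin; toℕ) renaming (zero to f0; suc to fs)
open import Data.Fin.Base using ()
open import Data.Bool using (Bool; true; false; _∧_; if_then_else_)
open import Data.Nat.ListAction using (sum)
open import Data.List using (List; map; allFin; cartesianProductWith)
open import Data.Product using (Σ; _×_; _,_; proj₁)
open import Data.Sum using (_⊎_; inj₁; inj₂)
open import Data.Unit using (⊤; tt)
open import Data.Empty using (⊥)
open import Relation.Nullary using (¬_)
open import Relation.Binary.PropositionalEquality using (_≡_; _≢_; refl)
open import Function.Definitions using (Injective)

record Graph (V : Set) : Set₁ where
  field
    Adj    : V → V → Set
    sym    : ∀ {u v} → Adj u v → Adj v u
    irrefl : ∀ {v} → ¬ Adj v v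
open Graph public

fromRel : {V : Set} (R : V → V → Set) → (∀ {v} → ¬ R v v) → Graph V
fromRel R irr = record
  { Adj    = λ u v → R u v ⊎ R v u
  ; sym    = λ { (inj₁ r) → inj₂ r ; (inj₂ r) → inj₁ r }
  ; irrefl = λ { (inj₁ r) → irr r ; (inj₂ r) → irr r } }

_⊑_ : {V W : Set} → Graph V → Graph W → Set
_⊑_ {V} {W} H G =
  Σ (V → W) λ f → Injective _≡_ _≡_ f
    × (∀ {u v} → Adj H u v → Adj G (f u) (f v))

record FinGraph (n : ℕ) : Set where
  field
    adj     : Fin n → Fin n → Bool
    adj-sym : ∀ u v → adj u v ≡ adj v u
    adj-irr : ∀ v → adj v v ≡ false
open FinGraph public

toGraph : ∀ {n} → FinGraph n → Graph (Fin n)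
toGraph G = record
  { Adj    = λ u v → adj G u v ≡ true
  ; sym    = λ {u} {v} e → sym' u v e
  ; irrefl = λ {v} e → noLoop v e }
  where
    sym' : ∀ u v → adj G u v ≡ true → adj G v u ≡ true
    sym' u v e with adj G v u | adj-sym G u v
    ... | b | refl = e
    noLoop : ∀ v → ¬ (adj G v v ≡ true)
    noLoop v e with adj G v v | adj-irr G v
    noLoop v () | .false | refl

edges : ∀ {n} → FinGraph n → ℕ
edges {n} G = sum (cartesianProductWith
  (λ i j → if (toℕ i <ᵇ toℕ j) ∧ adj G i j then 1 else 0)
  (allFin n) (allFin n))

IsEx : {V : Set} → ℕ → Graph V → ℕ → Set
IsEx n H m =
  (Σ (FinGraph n) λ G → ¬ (H ⊑ toGraph G) × edges G ≡ m)
  × (∀ (G : FinGraph n) → ¬ (H ⊑ toGraph G) → edges G ≤ m)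

-- Bipartition with ordered parts (A , B): A = vertices with side true

record Bipartition {V : Set} (H : Graph V) : Set where
  field
    side   : V → Bool
    proper : ∀ {u v} → Adj H u v → side u ≢ side v
open Bipartition public

-- L_3(H): new vertex u, joined to each a ∈ A by a path u - m_a - a
-- of length 2 with new internal vertex m_a.
module _ {V : Set} (H : Graph V) (P : Bipartition H) where
  PartA : Set
  PartA = Σ V λ v → side P v ≡ true

  L3V : Set
  L3V = V ⊎ (⊤ ⊎ PartA)   -- old vertices, u, midpoints

  data L3Rel : L3V → L3V → Set where
    old : ∀ {x y} → Adj H x y → L3Rel (inj₁ x) (inj₁ y)
    hub : (a : PartA) → L3Rel (inj₂ (inj₁ tt)) (inj₂ (inj₂ a))
    leg : (a : PartA) → L3Rel (inj₂ (inj₂ a)) (inj₁ (proj₁ a))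

  L3Rel-irr : ∀ {v} → ¬ L3Rel v v
  L3Rel-irr (old e) = irrefl H e

  L₃ : Graph L3V
  L₃ = fromRel L3Rel L3Rel-irr

data ThV (p : ℕ) : Set where
  x y : ThV p
  s r : Fin p → ThV p

data ThRel {p : ℕ} : ThV p → ThV p → Set where
  xs : (i : Fin p) → ThRel x (s i)
  sr : (i : Fin p) → ThRel (s i) (r i)
  ry : (i : Fin p) → ThRel (r i) y

ThRel-irr : ∀ {p} {v : ThV p} → ¬ ThRel v v
ThRel-irr ()

θ₃ : (p : ℕ) → Graph (ThV p)
θ₃ p = fromRel ThRel ThRel-irr

thSide : ∀ {p} → ThV p → Bool
thSide x     = true
thSide y     = false
thSide (s i) = false
thSide (r i) = true

θ₃-bip : (p : ℕ) → Bipartition (θ₃ p)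
θ₃-bip p = record { side = thSide ; proper = pr }
  where
    pr : ∀ {u v} → Adj (θ₃ p) u v → thSide u ≢ thSide v
    pr (inj₁ (xs i)) ()
    pr (inj₁ (sr i)) ()
    pr (inj₁ (ry i)) ()
    pr (inj₂ (xs i)) ()
    pr (inj₂ (sr i)) ()
    pr (inj₂ (ry i)) ()

L3θ : (p : ℕ) → Graph (L3V (θ₃ p) (θ₃-bip p))
L3θ p = L₃ (θ₃ p) (θ₃-bip p)

-- S_p: identified leaves prime 0,1,2 (= a', b', c'), and for each copy
-- i < p the path cv i 0 - cv i 1 - cv i 2 (= a b c), with cv i j ~ prime j.

data SV (p : ℕ) : Set where
  prime : Fin 3 → SV p
  cv    : Fin p → Fin 3 → SV p

data SRel {p : ℕ} : SV p → SV p → Set where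
  ab  : (i : Fin p) → SRel (cv i f0) (cv i (fs f0))
  bc  : (i : Fin p) → SRel (cv i (fs f0)) (cv i (fs (fs f0)))
  pen : (i : Fin p) (j : Fin 3) → SRel (cv i j) (prime j)

SRel-irr : ∀ {p} {v : SV p} → ¬ SRel v v
SRel-irr ()

S : (p : ℕ) → Graph (SV p)
S p = fromRel SRel SRel-irr

-- Send the identified leaves a', b', c' of S_p to the ends x, y of θ_{3,p}
-- and to the new vertex u of L_3, and the path a b c of the i-th comb to
-- s_i, r_i and the midpoint of the leg from u to r_i. Then a b, a a' and
-- b b' become the θ-edges s_i r_i, x s_i, r_i y, while b c and c c' are
-- the two edges of that leg. Since containing S_p is implied by containing
-- L_3(θ_{3,p}), every S_p-free graph is L_3(θ_{3,p})-free, which compares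
-- the extremal numbers.
module Submission where

open import Defs
open import Data.Nat using (ℕ; _≤_)
open import Data.Product using (_×_; _,_)
open import Data.Sum using (inj₁; inj₂)
open import Data.Unit using (tt)
open import Data.Fin using () renaming (zero to f0; suc to fs)
open import Relation.Nullary using (¬_)
open import Relation.Binary.PropositionalEquality using (_≡_; refl; subst)
open import Function.Consequences.Propositional
  using (inverseʳ⇒injective; strictlyInverseʳ⇒inverseʳ)

⊑-trans : {U V W : Set} {A : Graph U} {B : Graph V} {C : Graph W} →
          A ⊑ B → B ⊑ C → A ⊑ C
⊑-trans (f , f-inj , f-hom) (g , g-inj , g-hom) =
  (λ v → g (f v)) , (λ e → f-inj (g-inj e)) , (λ e → g-hom (f-hom e))

fromRel-hom : {V W : Set} {R : V → V → Set} (R-irr : ∀ {v} → ¬ R v v)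
              (G : Graph W) (f : V → W) →
              (∀ {u v} → R u v → Adj G (f u) (f v)) →
              ∀ {u v} → Adj (fromRel R R-irr) u v → Adj G (f u) (f v)
fromRel-hom _ G f hom (inj₁ e) = hom e
fromRel-hom _ G f hom (inj₂ e) = sym G (hom e)

ex-antitone : {V W : Set} {H : Graph V} {H′ : Graph W} (n a b : ℕ) →
              H ⊑ H′ → IsEx n H a → IsEx n H′ b → a ≤ b
ex-antitone {H = H} {H′} n a b H⊑H′
            ((G , H-free , edges≡a) , _) (_ , H′-free⇒≤b) =
  subst (_≤ b) edges≡a
    (H′-free⇒≤b G (λ H′⊑G → H-free (⊑-trans {A = H} {H′} {toGraph G} H⊑H′ H′⊑G)))

module _ (p : ℕ) where

  private
    embed : SV p → L3V (θ₃ p) (θ₃-bip p)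
    embed (prime f0)           = inj₁ x
    embed (prime (fs f0))      = inj₁ y
    embed (prime (fs (fs f0))) = inj₂ (inj₁ tt)
    embed (cv i f0)            = inj₁ (s i)
    embed (cv i (fs f0))       = inj₁ (r i)
    embed (cv i (fs (fs f0)))  = inj₂ (inj₂ (r i , refl))

    -- The midpoint of the leg to x is not in the image; its value is arbitrary.
    retract : L3V (θ₃ p) (θ₃-bip p) → SV p
    retract (inj₁ x)                 = prime f0
    retract (inj₁ y)                 = prime (fs f0)
    retract (inj₂ (inj₁ tt))         = prime (fs (fs f0))
    retract (inj₁ (s i))             = cv i f0
    retract (inj₁ (r i))             = cv i (fs f0)
    retract (inj₂ (inj₂ (r i , _)))  = cv i (fs (fs f0))
    retract (inj₂ (inj₂ (x , _)))    = prime f0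
    retract (inj₂ (inj₂ (y , ())))
    retract (inj₂ (inj₂ (s _ , ())))

    retract∘embed : ∀ v → retract (embed v) ≡ v
    retract∘embed (prime f0)           = refl
    retract∘embed (prime (fs f0))      = refl
    retract∘embed (prime (fs (fs f0))) = refl
    retract∘embed (cv i f0)            = refl
    retract∘embed (cv i (fs f0))       = refl
    retract∘embed (cv i (fs (fs f0)))  = refl

    embed-hom : ∀ {u v} → SRel u v → Adj (L3θ p) (embed u) (embed v)
    embed-hom (ab i)               = inj₁ (old (inj₁ (sr i)))
    embed-hom (bc i)               = inj₂ (leg (r i , refl))
    embed-hom (pen i f0)           = inj₁ (old (inj₂ (xs i)))
    embed-hom (pen i (fs f0))      = inj₁ (old (inj₁ (ry i)))
    embed-hom (pen i (fs (fs f0))) = inj₂ (hub (r i , refl))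

  S⊑L3θ : S p ⊑ L3θ p
  S⊑L3θ =
    embed ,
    inverseʳ⇒injective embed (strictlyInverseʳ⇒inverseʳ {f⁻¹ = retract} embed retract∘embed) ,
    fromRel-hom SRel-irr (L3θ p) embed embed-hom

-- The embedding exists for every p.
proposition5p1 : (p : ℕ) → 2 ≤ p →
    (S p ⊑ L3θ p)
    × (∀ (n a b : ℕ) → IsEx n (S p) a → IsEx n (L3θ p) b → a ≤ b)
proposition5p1 p _ = S⊑L3θ p , λ n a b → ex-antitone {H = S p} {L3θ p} n a b (S⊑L3θ p)
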